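{- Let $n\ge1$ and let $T=\{t_1<t_2<\dots<t_n\}$ be a set of positive integers with $t_i\le 3i-2$ for all $i\in[n]$. Then there is a unique permutation $\pi\in\mathcal{B}_{3n}$ with $T_1(\pi)=T$.
   Context: Permutations are written in one-line notation $\pi=\pi_1\cdots\pi_m$, $\pi_i=\pi(i)$; a permutation avoids $\sigma$ if no subsequence is in the same relative order as $\sigma$. $\mathcal{S}^\star_{3n}$ is the set of permutations of $[3n]$ whose cycle decomposition consists only of 3-cycles. If $\{a<b<c\}$ is a 3-cycle of $\pi$, $\pi_a\pi_b\pi_c$ is in relative order 312 or 231, and the cycle is called of the form 312 or 231 accordingly. $\mathcal{B}_{3n}$ is the set of 321-avoiding permutations in $\mathcal{S}^\star_{3n}$ all of whose 3-cycles are of the form 312. For $\pi\in\mathcal{B}_{3n}$, $T_1(\pi)$ is the set of values that are the smallest element of their 3-cycle. -}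

module Defs where

open import Data.Nat using (ℕ; suc; _+_; _*_; _≤_)
import Data.Nat as ℕ
open import Data.Fin using (Fin; toℕ; _<_)
open import Data.Fin.Permutation using (Permutation′; _⟨$⟩ʳ_)
open import Data.Product using (_×_; ∃)
open import Data.Sum using (_⊎_)
open import Relation.Nullary using (¬_)
open import Relation.Binary.PropositionalEquality using (_≡_; _≢_)

-- Positions/values of [m] are represented by Fin m, with p : Fin m
-- standing for the integer  toℕ p + 1.

OnlyThreeCycles : ∀ {m} → Permutation′ m → Set
OnlyThreeCycles {m} π = ∀ (i : Fin m) →
  (π ⟨$⟩ʳ i ≢ i) × (π ⟨$⟩ʳ (π ⟨$⟩ʳ i) ≢ i) × (π ⟨$⟩ʳ (π ⟨$⟩ʳ (π ⟨$⟩ʳ i)) ≡ i)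

Avoids321 : ∀ {m} → Permutation′ m → Set
Avoids321 {m} π = ∀ (i j k : Fin m) → i < j → j < k →
  ¬ ((π ⟨$⟩ʳ k < π ⟨$⟩ʳ j) × (π ⟨$⟩ʳ j < π ⟨$⟩ʳ i))

IsThreeCycle : ∀ {m} → Permutation′ m → Fin m → Fin m → Fin m → Set
IsThreeCycle π a b c =
    ((π ⟨$⟩ʳ a ≡ b) × (π ⟨$⟩ʳ b ≡ c) × (π ⟨$⟩ʳ c ≡ a))
  ⊎ ((π ⟨$⟩ʳ a ≡ c) × (π ⟨$⟩ʳ c ≡ b) × (π ⟨$⟩ʳ b ≡ a))

All312 : ∀ {m} → Permutation′ m → Set
All312 {m} π = ∀ (a b c : Fin m) → a < b → b < c → IsThreeCycle π a b c →
  (π ⟨$⟩ʳ b < π ⟨$⟩ʳ c) × (π ⟨$⟩ʳ c < π ⟨$⟩ʳ a)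

InB : ∀ {m} → Permutation′ m → Set
InB π = OnlyThreeCycles π × Avoids321 π × All312 π

InT1 : ∀ {m} → Permutation′ m → Fin m → Set
InT1 π x = (x < π ⟨$⟩ʳ x) × (x < π ⟨$⟩ʳ (π ⟨$⟩ʳ x))

-- T = {t_1 < ... < t_n} given by t : Fin n → ℕ (t i = t_{i+1}).
StrictlyIncreasing : ∀ {n} → (Fin n → ℕ) → Set
StrictlyIncreasing {n} t = ∀ (i j : Fin n) → i < j → t i ℕ.< t j

-- t_i ≥ 1 and t_i ≤ 3i-2 (1-indexed i), i.e. t (i) ≤ 3·toℕ i + 1 for 0-indexed i.
Admissible : ∀ {n} → (Fin n → ℕ) → Set
Admissible {n} t = StrictlyIncreasing t × (∀ (i : Fin n) → 1 ≤ t i × t i ≤ 3 * toℕ i + 1)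

T1Equals : ∀ {m n} → Permutation′ m → (Fin n → ℕ) → Set
T1Equals {m} {n} π t = ∀ (x : Fin m) →
  (InT1 π x → ∃ λ (i : Fin n) → t i ≡ suc (toℕ x)) ×
  ((∃ λ (i : Fin n) → t i ≡ suc (toℕ x)) → InT1 π x)

-- In π ∈ B every 3-cycle a < b < c acts as a ↦ c ↦ b ↦ a, so T₁(π) is the set of
-- excedances, π(x) < x off T₁, and 321-avoidance makes π increasing both on T₁ and off
-- T₁. Hence the non-T₁ positions, in increasing order, are matched with the positions
-- that are not the largest of their cycle, in increasing order.
--
-- Uniqueness: if σ, τ ∈ B have the same T₁, then σ and τ agree at every x ∉ T₁, by
-- induction on x; their values on T₁ are then forced.
--
-- Existence: scan the positions from left to right, giving each one a role. A position
-- of T is smallest; any other position x is matched with the leftmost unmatched position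
-- s that is not largest, and x is middle or largest according as s is smallest or
-- middle. The counts of roles before x keep track of which s comes next; the bound
-- t_i ≤ 3i − 2 guarantees that such an s exists whenever x ∉ T, and at the end every
-- non-largest position has been matched. The matching then defines π.

module Submission where

open import Defs
open import Data.Nat using (ℕ; _*_; _≤_)
open import Data.Fin using (Fin)
open import Data.Fin.Permutation using (Permutation′; _⟨$⟩ʳ_)
open import Data.Product using (_×_; Σ)
open import Relation.Binary.PropositionalEquality using (_≡_)

open import Algebra.Properties.CommutativeSemigroup as CommutativeSemigroupProperties using ()
open import Data.Bool using (Bool; true; false; _∧_; not; if_then_else_)
open import Data.Bool.Properties using (T-≡; not-¬; not-injective)
open import Data.Empty using (⊥; ⊥-elim)
open import Data.Fin as Fin using (toℕ; fromℕ<)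
open import Data.Fin.Induction using () renaming (<-wellFounded to <-wellFounded-Fin)
open import Data.Fin.Permutation using (_⟨$⟩ˡ_; inverseˡ; permutation)
open import Data.Fin.Properties using (toℕ<n; toℕ-injective; toℕ-fromℕ<; any?)
open import Data.Fin.Subset using (Subset; _∈_; _⊆_; _⊂_; ∣_∣)
open import Data.Fin.Subset.Properties using (∣p∣≤n; p⊆q⇒∣p∣≤∣q∣; p⊂q⇒∣p∣<∣q∣)
open import Data.Maybe using (Maybe; just; nothing; maybe′; fromMaybe)
open import Data.Nat as ℕ
  using (zero; suc; _+_; _∸_; _<_; _≤?_; _<?_; _≡ᵇ_; z≤n; s≤s; >-nonZero)
open import Data.Nat.Induction using (<-wellFounded)
open import Data.Nat.Properties
open import Data.Product using (∃; _,_; proj₁; proj₂; swap)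
open import Data.Sum using (_⊎_; inj₁; inj₂; [_,_]′; map₁)
open import Data.Vec using (tabulate)
open import Data.Vec.Properties using (lookup∘tabulate; lookup⇒[]=; []=⇒lookup)
open import Function using (_∘′_; id)
open import Function.Bundles using (Equivalence; _⇔_; mk⇔)
open import Induction.WellFounded using (module All; module FixPoint)
open import Relation.Binary.Definitions using (tri<; tri≈; tri>)
open import Relation.Binary.PropositionalEquality
  using (_≢_; refl; sym; trans; cong; cong₂; subst; subst₂; module ≡-Reasoning)
open import Relation.Nullary using (¬_; Dec; yes; no; does)
open import Relation.Nullary.Decidable using (dec-true)

-- Uniqueness

≢⇒<⊎> : ∀ {m} {x y : Fin m} → x ≢ y → x Fin.< y ⊎ y Fin.< x
≢⇒<⊎> {x = x} {y} x≢y with <-cmp (toℕ x) (toℕ y)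
... | tri< x<y _ _ = inj₁ x<y
... | tri≈ _ x≡y _ = ⊥-elim (x≢y (toℕ-injective x≡y))
... | tri> _ _ y<x = inj₂ y<x

InT1? : ∀ {m} (σ : Permutation′ m) x → Dec (InT1 σ x)
InT1? σ x with x Fin.<? σ ⟨$⟩ʳ x | x Fin.<? σ ⟨$⟩ʳ (σ ⟨$⟩ʳ x)
... | yes x<σx | yes x<σσx = yes (x<σx , x<σσx)
... | no x≮σx  | _          = no (λ x∈T1 → x≮σx (proj₁ x∈T1))
... | yes _    | no x≮σσx   = no (λ x∈T1 → x≮σσx (proj₂ x∈T1))

module InB-Properties {m} (σ : Permutation′ m) (σ∈B : InB σ) where

  π : Fin m → Fin m
  π = σ ⟨$⟩ʳ_

  π³≗id : ∀ x → π (π (π x)) ≡ x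
  π³≗id x = proj₂ (proj₂ (proj₁ σ∈B x))

  π-injective : ∀ {x y} → π x ≡ π y → x ≡ y
  π-injective {x} {y} πx≡πy =
    trans (sym (inverseˡ σ)) (trans (cong (σ ⟨$⟩ˡ_) πx≡πy) (inverseˡ σ))

  π⁴≗π : ∀ x → π (π (π (π x))) ≡ π x
  π⁴≗π x = cong π (π³≗id x)

  π≢id : ∀ x → π x ≢ x
  π≢id x = proj₁ (proj₁ σ∈B x)

  π²≢id : ∀ x → π (π x) ≢ x
  π²≢id x = proj₁ (proj₂ (proj₁ σ∈B x))

  avoids-321 : Avoids321 σ
  avoids-321 = proj₁ (proj₂ σ∈B)

  all-312 : All312 σ
  all-312 = proj₂ (proj₂ σ∈B)

  -- Otherwise π²x < x < πx would be a 3-cycle of the form 231.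
  ¬InT1⇒π< : ∀ x → ¬ InT1 σ x → π x Fin.< x
  ¬InT1⇒π< x x∉T1 with ≢⇒<⊎> (π≢id x)
  ... | inj₁ πx<x = πx<x
  ... | inj₂ x<πx with ≢⇒<⊎> (π²≢id x)
  ...   | inj₂ x<π²x = ⊥-elim (x∉T1 (x<πx , x<π²x))
  ...   | inj₁ π²x<x = ⊥-elim (<-asym πx<π²x (<-trans π²x<x x<πx))
    where
    πx<π²x : π x Fin.< π (π x)
    πx<π²x = proj₁ (all-312 (π (π x)) x (π x) π²x<x x<πx (inj₁ (π³≗id x , refl , refl)))

  orbit-meets-T1 : ∀ x → InT1 σ x ⊎ InT1 σ (π x) ⊎ InT1 σ (π (π x))
  orbit-meets-T1 x with InT1? σ x | InT1? σ (π x)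
  ... | yes x∈T1 | _         = inj₁ x∈T1
  ... | no _     | yes πx∈T1 = inj₂ (inj₁ πx∈T1)
  ... | no x∉T1  | no πx∉T1  = inj₂ (inj₂ (π²x<π³x , π²x<π⁴x))
    where
    π²x<π³x : π (π x) Fin.< π (π (π x))
    π²x<π³x = subst (λ y → π (π x) Fin.< y) (sym (π³≗id x))
                (<-trans (¬InT1⇒π< (π x) πx∉T1) (¬InT1⇒π< x x∉T1))
    π²x<π⁴x : π (π x) Fin.< π (π (π (π x)))
    π²x<π⁴x = subst (λ y → π (π x) Fin.< y) (sym (π⁴≗π x))
                (¬InT1⇒π< (π x) πx∉T1)

  -- If π y < π x, then (πx, x, y) or (π²x, x, y) is an occurrence of 321.
  π-monotone-from-¬InT1 : ∀ {x y} → ¬ InT1 σ x → x Fin.< y → π x Fin.< π y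
  π-monotone-from-¬InT1 {x} {y} x∉T1 x<y =
    by-cases (≢⇒<⊎> (<⇒≢ x<y ∘′ cong toℕ ∘′ π-injective)) (≢⇒<⊎> (π≢id (π x) ∘′ sym))
    where
    πx<x : π x Fin.< x
    πx<x = ¬InT1⇒π< x x∉T1
    πx<π³x : π x Fin.< π (π (π x))
    πx<π³x = subst (λ z → π x Fin.< z) (sym (π³≗id x)) πx<x
    by-cases : π x Fin.< π y ⊎ π y Fin.< π x → π x Fin.< π (π x) ⊎ π (π x) Fin.< π x →
               π x Fin.< π y
    by-cases (inj₁ πx<πy) _ = πx<πy
    by-cases (inj₂ πy<πx) (inj₁ πx<π²x) =
      ⊥-elim (avoids-321 (π x) x y πx<x x<y (πy<πx , πx<π²x))
    by-cases (inj₂ πy<πx) (inj₂ π²x<πx) =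
      ⊥-elim (avoids-321 (π (π x)) x y (<-trans π²x<πx πx<x) x<y (πy<πx , πx<π³x))

SameT1 : ∀ {m} → Permutation′ m → Permutation′ m → Set
SameT1 σ τ = (∀ x → InT1 σ x → InT1 τ x) × (∀ x → InT1 τ x → InT1 σ x)

module AgreementStep {m} (σ τ : Permutation′ m) (σ∈B : InB σ) (τ∈B : InB τ)
  (sameT1 : SameT1 σ τ) where

  σ⊆τ : ∀ x → InT1 σ x → InT1 τ x
  σ⊆τ = proj₁ sameT1

  τ⊆σ : ∀ x → InT1 τ x → InT1 σ x
  τ⊆σ = proj₂ sameT1

  open InB-Properties σ σ∈B using (¬InT1⇒π<; orbit-meets-T1)
    renaming (π to σ̂; π-injective to σ̂-injective)
  open InB-Properties τ τ∈B using ()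
    renaming (π to τ̂; π³≗id to τ̂³≗id; π-monotone-from-¬InT1 to τ̂-monotone-from-¬InT1)

  ¬σ̂<τ̂ : ∀ x → (∀ y → y Fin.< x → ¬ InT1 σ y → σ̂ y ≡ τ̂ y) → ¬ InT1 σ x →
          ¬ σ̂ x Fin.< τ̂ x
  ¬σ̂<τ̂ x agree x∉T1 σ̂x<τ̂x = by-cases (InT1? τ y)
    where
    v : Fin m
    v = σ̂ x
    y : Fin m
    y = τ̂ (τ̂ v)
    τ̂y≡v : τ̂ y ≡ v
    τ̂y≡v = τ̂³≗id v
    v<x : v Fin.< x
    v<x = ¬InT1⇒π< x x∉T1
    x∉T1τ : ¬ InT1 τ x
    x∉T1τ x∈T1 = x∉T1 (τ⊆σ x x∈T1)
    by-cases : Dec (InT1 τ y) → ⊥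
    by-cases (yes (y<τ̂y , y<τ̂²y)) with orbit-meets-T1 x
    ... | inj₁ x∈T1 = x∉T1 x∈T1
    ... | inj₂ (inj₁ v∈T1) = v∉T1τ (σ⊆τ v v∈T1)
      where
      v∉T1τ : ¬ InT1 τ v
      v∉T1τ (_ , v<y) = <-asym v<y (subst (λ z → y Fin.< z) τ̂y≡v y<τ̂y)
    ... | inj₂ (inj₂ σ̂v∈T1) = τ̂v∉T1τ (subst (InT1 τ) σ̂v≡τ̂v (σ⊆τ (σ̂ v) σ̂v∈T1))
      where
      y<τ̂v : y Fin.< τ̂ v
      y<τ̂v = subst (λ z → y Fin.< τ̂ z) τ̂y≡v y<τ̂²y
      v∉T1σ : ¬ InT1 σ v
      v∉T1σ v∈T1 = <-asym (subst (λ z → y Fin.< z) τ̂y≡v y<τ̂y) (proj₂ (σ⊆τ v v∈T1))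
      σ̂v≡τ̂v : σ̂ v ≡ τ̂ v
      σ̂v≡τ̂v = agree v v<x v∉T1σ
      τ̂v∉T1τ : ¬ InT1 τ (τ̂ v)
      τ̂v∉T1τ (τ̂v<y , _) = <-asym τ̂v<y y<τ̂v
    by-cases (no y∉T1) with <-cmp (toℕ y) (toℕ x)
    ... | tri< y<x _ _ = <⇒≢ y<x (cong toℕ (σ̂-injective σ̂y≡σ̂x))
      where
      σ̂y≡σ̂x : σ̂ y ≡ σ̂ x
      σ̂y≡σ̂x = trans (agree y y<x (λ y∈T1 → y∉T1 (σ⊆τ y y∈T1))) τ̂y≡v
    ... | tri≈ _ y≡x _ =
      <-irrefl (cong toℕ (trans (sym τ̂y≡v) (cong τ̂ (toℕ-injective y≡x)))) σ̂x<τ̂x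
    ... | tri> _ _ x<y =
      <-asym σ̂x<τ̂x (subst (λ z → τ̂ x Fin.< z) τ̂y≡v (τ̂-monotone-from-¬InT1 x∉T1τ x<y))

InB-agree-off-T1 : ∀ {m} (σ τ : Permutation′ m) → InB σ → InB τ → SameT1 σ τ →
                   ∀ x → ¬ InT1 σ x → σ ⟨$⟩ʳ x ≡ τ ⟨$⟩ʳ x
InB-agree-off-T1 σ τ σ∈B τ∈B sameT1@(_ , τ⊆σ) =
  All.wfRec <-wellFounded-Fin _ (λ x → ¬ InT1 σ x → σ ⟨$⟩ʳ x ≡ τ ⟨$⟩ʳ x) step
  where
  step : ∀ x → (∀ {y} → y Fin.< x → ¬ InT1 σ y → σ ⟨$⟩ʳ y ≡ τ ⟨$⟩ʳ y) →
         ¬ InT1 σ x → σ ⟨$⟩ʳ x ≡ τ ⟨$⟩ʳ x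
  step x agree x∉T1 with <-cmp (toℕ (σ ⟨$⟩ʳ x)) (toℕ (τ ⟨$⟩ʳ x))
  ... | tri≈ _ σx≡τx _ = toℕ-injective σx≡τx
  ... | tri< σx<τx _ _ =
    ⊥-elim (AgreementStep.¬σ̂<τ̂ σ τ σ∈B τ∈B sameT1 x (λ y → agree {y}) x∉T1 σx<τx)
  ... | tri> _ _ τx<σx =
    ⊥-elim (AgreementStep.¬σ̂<τ̂ τ σ τ∈B σ∈B (swap sameT1) x
      (λ y y<x y∉T1 → sym (agree y<x (λ y∈T1 → y∉T1 (proj₁ sameT1 y y∈T1))))
      (λ x∈T1 → x∉T1 (τ⊆σ x x∈T1)) τx<σx)

InB-unique-by-T1 : ∀ {m} (σ τ : Permutation′ m) → InB σ → InB τ → SameT1 σ τ →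
                   ∀ x → σ ⟨$⟩ʳ x ≡ τ ⟨$⟩ʳ x
InB-unique-by-T1 σ τ σ∈B τ∈B sameT1 x with InT1? σ x
... | no x∉T1 = InB-agree-off-T1 σ τ σ∈B τ∈B sameT1 x x∉T1
... | yes (x<σ̂x , x<σ̂²x) = sym τ̂x≡σ̂x
  where
  open InB-Properties σ σ∈B renaming (π to σ̂; π³≗id to σ̂³≗id)
  open InB-Properties τ τ∈B using () renaming (π to τ̂; π³≗id to τ̂³≗id)
  agree : ∀ y → ¬ InT1 σ y → σ̂ y ≡ τ̂ y
  agree = InB-agree-off-T1 σ τ σ∈B τ∈B sameT1
  σ̂x∉T1 : ¬ InT1 σ (σ̂ x)
  σ̂x∉T1 (_ , σ̂x<x) = <-asym x<σ̂x (subst (λ z → σ̂ x Fin.< z) (σ̂³≗id x) σ̂x<x)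
  σ̂²x∉T1 : ¬ InT1 σ (σ̂ (σ̂ x))
  σ̂²x∉T1 (σ̂²x<x , _) = <-asym x<σ̂²x (subst (λ z → σ̂ (σ̂ x) Fin.< z) (σ̂³≗id x) σ̂²x<x)
  τ̂x≡σ̂x : τ̂ x ≡ σ̂ x
  τ̂x≡σ̂x = begin
    τ̂ x                     ≡⟨ cong τ̂ (sym (σ̂³≗id x)) ⟩
    τ̂ (σ̂ (σ̂ (σ̂ x)))         ≡⟨ cong τ̂ (agree (σ̂ (σ̂ x)) σ̂²x∉T1) ⟩
    τ̂ (τ̂ (σ̂ (σ̂ x)))         ≡⟨ cong (λ z → τ̂ (τ̂ z)) (agree (σ̂ x) σ̂x∉T1) ⟩
    τ̂ (τ̂ (τ̂ (σ̂ x)))         ≡⟨ τ̂³≗id (σ̂ x) ⟩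
    σ̂ x                     ∎
    where open ≡-Reasoning

-- Search and counting along a sequence

search : (ℕ → Bool) → ℕ → Maybe ℕ
search P zero    = nothing
search P (suc N) = if P N then just N else search P N

search-cong : ∀ {P Q} N → (∀ {y} → y < N → P y ≡ Q y) → search P N ≡ search Q N
search-cong zero    P≗Q = refl
search-cong (suc N) P≗Q =
  cong₂ (if_then just N else_) (P≗Q ≤-refl) (search-cong N (λ y<N → P≗Q (m<n⇒m<1+n y<N)))

search-sound : ∀ P N {r} → search P N ≡ just r → P r ≡ true × r < N
search-sound P (suc N) found with P N in PN
... | true  with found
...   | refl = PN , ≤-refl
search-sound P (suc N) found | false with search-sound P N found
...   | Pr , r<N = Pr , m<n⇒m<1+n r<N

search-unique : ∀ P N {s} → P s ≡ true → s < N → (∀ {y} → y < N → P y ≡ true → y ≡ s) →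
                search P N ≡ just s
search-unique P (suc N) {s} Ps s<1+N unique with P N in PN
... | true  = cong just (unique ≤-refl PN)
... | false with m≤n⇒m<n∨m≡n (≤-pred s<1+N)
...   | inj₁ s<N = search-unique P N Ps s<N (λ y<N → unique (m<n⇒m<1+n y<N))
...   | inj₂ refl with () ← trans (sym PN) Ps

χ : Bool → ℕ
χ b = if b then 1 else 0

module _ {A : Set} where

  count : (A → Bool) → (ℕ → A) → ℕ → ℕ
  count p h zero    = 0
  count p h (suc y) = count p h y + χ (p (h y))

  count-cong : ∀ p {h h′} y → (∀ {z} → z < y → h z ≡ h′ z) → count p h y ≡ count p h′ y
  count-cong p zero    h≗h′ = refl
  count-cong p (suc y) h≗h′ =
    cong₂ _+_ (count-cong p y (λ z<y → h≗h′ (m<n⇒m<1+n z<y))) (cong (χ ∘′ p) (h≗h′ ≤-refl))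

  count-hit : ∀ p h y → p (h y) ≡ true → count p h (suc y) ≡ suc (count p h y)
  count-hit p h y hit rewrite hit = +-comm (count p h y) 1

  count-miss : ∀ p h y → p (h y) ≡ false → count p h (suc y) ≡ count p h y
  count-miss p h y miss rewrite miss = +-identityʳ (count p h y)

  count-mono : ∀ p h {y z} → y ≤ z → count p h y ≤ count p h z
  count-mono p h {z = zero}  z≤n = ≤-refl
  count-mono p h {z = suc z} y≤1+z with m≤n⇒m<n∨m≡n y≤1+z
  ... | inj₁ y<1+z = ≤-trans (count-mono p h (≤-pred y<1+z)) (m≤m+n _ _)
  ... | inj₂ refl  = ≤-refl

  count-split : ∀ {p q r} h y → (∀ a → χ (r a) ≡ χ (p a) + χ (q a)) →
                count r h y ≡ count p h y + count q h y
  count-split h zero    χr≗χp+χq = refl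
  count-split {p} {q} {r} h (suc y) χr≗χp+χq = begin
    count r h y + χ (r (h y))
      ≡⟨ cong₂ _+_ (count-split h y χr≗χp+χq) (χr≗χp+χq (h y)) ⟩
    (count p h y + count q h y) + (χ (p (h y)) + χ (q (h y)))
      ≡⟨ +-interchange (count p h y) (count q h y) (χ (p (h y))) (χ (q (h y))) ⟩
    count p h (suc y) + count q h (suc y) ∎
    where
    open ≡-Reasoning
    open CommutativeSemigroupProperties +-commutativeSemigroup
      renaming (interchange to +-interchange)

  count-all : ∀ h y → count (λ _ → true) h y ≡ y
  count-all h zero    = refl
  count-all h (suc y) = trans (cong (_+ 1) (count-all h y)) (+-comm y 1)

  count-strict : ∀ p h {y z} → p (h y) ≡ true → y < z → count p h y < count p h z
  count-strict p h {y} {z} hit y<z =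
    subst (_≤ count p h z) (count-hit p h y hit) (count-mono p h y<z)

  count-injective : ∀ p h {y z} → p (h y) ≡ true → p (h z) ≡ true →
                    count p h y ≡ count p h z → y ≡ z
  count-injective p h {y} {z} hit-y hit-z same with <-cmp y z
  ... | tri< y<z _ _ = ⊥-elim (<-irrefl same (count-strict p h hit-y y<z))
  ... | tri≈ _ y≡z _ = y≡z
  ... | tri> _ _ z<y = ⊥-elim (<-irrefl (sym same) (count-strict p h hit-z z<y))

  count-reflects-< : ∀ p h {y z} → p (h y) ≡ true → p (h z) ≡ true →
                     count p h y < count p h z → y < z
  count-reflects-< p h {y} {z} hit-y hit-z count< with <-cmp y z
  ... | tri< y<z _ _ = y<z
  ... | tri≈ _ refl _ = ⊥-elim (<-irrefl refl count<)
  ... | tri> _ _ z<y = ⊥-elim (<-asym count< (count-strict p h hit-z z<y))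

  count-reaches : ∀ p h N {r} → r < count p h N →
                  Σ ℕ λ y → y < N × p (h y) ≡ true × count p h y ≡ r
  count-reaches p h (suc N) {r} r<count with p (h N) in hit
  ... | false with count-reaches p h N (subst (r <_) (+-identityʳ _) r<count)
  ...   | y , y<N , hit-y , count≡r = y , m<n⇒m<1+n y<N , hit-y , count≡r
  count-reaches p h (suc N) {r} r<count | true
    with m≤n⇒m<n∨m≡n (≤-pred (subst (r <_) (+-comm (count p h N) 1) r<count))
  ... | inj₂ r≡count = N , ≤-refl , hit , sym r≡count
  ... | inj₁ r<countN with count-reaches p h N r<countN
  ...   | y , y<N , hit-y , count≡r = y , m<n⇒m<1+n y<N , hit-y , count≡r

record FirstHit {A : Set} (p : A → Bool) (h : ℕ → A) (u w : ℕ) : Set where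
  field
    pos              : ℕ
    pos≤w            : pos ≤ w
    hit-or-end       : pos ≡ w ⊎ p (h pos) ≡ true
    counts-unchanged : ∀ q → (∀ a → p a ≡ false → q a ≡ false) → count q h pos ≡ count q h u

first-hit : ∀ {A : Set} p (h : ℕ → A) {u w} → u ≤ w → FirstHit p h u w
first-hit p h {u} {w} u≤w = subst (FirstHit p h u) (m∸n+n≡m u≤w) (search-from (w ∸ u) u)
  where
  search-from : ∀ d u → FirstHit p h u (d + u)
  search-from zero u = record
    { pos = u ; pos≤w = ≤-refl ; hit-or-end = inj₁ refl
    ; counts-unchanged = λ _ _ → refl }
  search-from (suc d) u with p (h u) in hit
  ... | true = record
    { pos = u ; pos≤w = m≤n+m u (suc d) ; hit-or-end = inj₂ hit
    ; counts-unchanged = λ _ _ → refl }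
  ... | false = record
    { pos = pos ; pos≤w = subst (pos ≤_) (+-suc d u) pos≤w
    ; hit-or-end = map₁ (λ pos≡ → trans pos≡ (+-suc d u)) hit-or-end
    ; counts-unchanged = λ q q⇒p →
        trans (counts-unchanged q q⇒p) (count-miss q h u (q⇒p (h u) hit)) }
    where open FirstHit (search-from d (suc u))

-- `default` is never observed, since `next` only looks below its argument.
module CourseOfValues {A : Set} (default : A) (next : (ℕ → A) → ℕ → A)
  (next-local : ∀ {h h′} x → (∀ {y} → y < x → h y ≡ h′ y) → next h x ≡ next h′ x) where

  private
    extend : ∀ x → (∀ {y} → y < x → A) → ℕ → A
    extend x h y with y <? x
    ... | yes y<x = h y<x
    ... | no _    = default

    extend-agrees : ∀ x {h h′ : ∀ {y} → y < x → A} → (∀ {y} (y<x : y < x) → h y<x ≡ h′ y<x) →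
                    ∀ {y} → y < x → extend x h y ≡ extend x h′ y
    extend-agrees x h≗h′ {y} y<x with y <? x
    ... | yes y<x′ = h≗h′ y<x′
    ... | no y≮x   = ⊥-elim (y≮x y<x)

    step : ∀ x → (∀ {y} → y < x → A) → A
    step x h = next (extend x h) x

    open FixPoint <-wellFounded (λ _ → A) step
      (λ x h≗h′ → next-local x (extend-agrees x h≗h′))

  opaque
    fix : ℕ → A
    fix = All.wfRec <-wellFounded _ (λ _ → A) step

    fix-unfold : ∀ x → fix x ≡ next fix x
    fix-unfold x = trans unfold-wfRec (next-local x extend-fix)
      where
      extend-fix : ∀ {y} → y < x → extend x (λ {y} _ → fix y) y ≡ fix y
      extend-fix {y} y<x with y <? x
      ... | yes _   = refl
      ... | no y≮x  = ⊥-elim (y≮x y<x)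

-- Existence

data Role : Set where
  smallest middle largest : Role

isSmallest isMiddle isLargest notSmallest notLargest : Role → Bool
isSmallest smallest = true
isSmallest _        = false
isMiddle middle = true
isMiddle _      = false
isLargest largest = true
isLargest _       = false
notSmallest = not ∘′ isSmallest
notLargest  = not ∘′ isLargest

isSmallest⇒≡ : ∀ {r} → isSmallest r ≡ true → r ≡ smallest
isSmallest⇒≡ {smallest} _ = refl

successor : Role → Role
successor smallest = middle
successor _        = largest

successor≡middle : ∀ {r} → successor r ≡ middle → r ≡ smallest
successor≡middle {smallest} _ = refl

χnotLargest≗ : ∀ r → χ (notLargest r) ≡ χ (isSmallest r) + χ (isMiddle r)
χnotLargest≗ smallest = refl
χnotLargest≗ middle   = refl
χnotLargest≗ largest  = refl

χnotSmallest≗ : ∀ r → χ (notSmallest r) ≡ χ (isMiddle r) + χ (isLargest r)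
χnotSmallest≗ smallest = refl
χnotSmallest≗ middle   = refl
χnotSmallest≗ largest  = refl

χall≗ : ∀ r → χ true ≡ χ (isSmallest r) + χ (notSmallest r)
χall≗ smallest = refl
χall≗ middle   = refl
χall≗ largest  = refl

∧≡ᵇ-sound : ∀ {b} a c → b ∧ (a ≡ᵇ c) ≡ true → b ≡ true × a ≡ c
∧≡ᵇ-sound {true} a c a≡ᵇc = refl , ≡ᵇ⇒≡ a c (Equivalence.from T-≡ a≡ᵇc)

∧≡ᵇ-complete : ∀ {b a c} → b ≡ true → a ≡ c → b ∧ (a ≡ᵇ c) ≡ true
∧≡ᵇ-complete {a = a} refl refl = Equivalence.to T-≡ (≡⇒≡ᵇ a a refl)

two-of-three-equal : ∀ (a b c : Bool) → a ≡ b ⊎ b ≡ c ⊎ a ≡ c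
two-of-three-equal true  true  _     = inj₁ refl
two-of-three-equal false false _     = inj₁ refl
two-of-three-equal true  false false = inj₂ (inj₁ refl)
two-of-three-equal false true  true  = inj₂ (inj₁ refl)
two-of-three-equal true  false true  = inj₂ (inj₂ refl)
two-of-three-equal false true  false = inj₂ (inj₂ refl)

does-sound : ∀ {A : Set} (a? : Dec A) → does a? ≡ true → A
does-sound (yes a) _ = a

module Construction (n : ℕ) (t : Fin n → ℕ) (adm : Admissible t) where

  InT : ℕ → Set
  InT x = ∃ λ i → t i ≡ suc x

  inT : ℕ → Bool
  inT x = does (any? λ i → t i ℕ.≟ suc x)

  isPartner : (ℕ → Role) → ℕ → ℕ → Bool
  isPartner h x y = notLargest (h y) ∧ (count notLargest h y ≡ᵇ count notSmallest h x)

  next : (ℕ → Role) → ℕ → Role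
  next h x = if inT x then smallest
             else maybe′ (successor ∘′ h) largest (search (isPartner h x) x)

  next-local : ∀ {h h′} x → (∀ {y} → y < x → h y ≡ h′ y) → next h x ≡ next h′ x
  next-local {h} {h′} x h≗h′ = cong (if inT x then smallest else_) (begin
    maybe′ (successor ∘′ h) largest (search (isPartner h x) x)
      ≡⟨ cong (maybe′ (successor ∘′ h) largest) (search-cong x isPartner≗) ⟩
    maybe′ (successor ∘′ h) largest (search (isPartner h′ x) x)
      ≡⟨ found-below (search (isPartner h′ x) x) refl ⟩
    maybe′ (successor ∘′ h′) largest (search (isPartner h′ x) x) ∎)
    where
    open ≡-Reasoning
    isPartner≗ : ∀ {y} → y < x → isPartner h x y ≡ isPartner h′ x y
    isPartner≗ {y} y<x = cong₂ _∧_ (cong notLargest (h≗h′ y<x))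
      (cong₂ _≡ᵇ_ (count-cong notLargest y (λ z<y → h≗h′ (<-trans z<y y<x)))
                  (count-cong notSmallest x h≗h′))
    found-below : ∀ r → search (isPartner h′ x) x ≡ r →
                  maybe′ (successor ∘′ h) largest r ≡ maybe′ (successor ∘′ h′) largest r
    found-below nothing  _     = refl
    found-below (just y) found = cong successor (h≗h′ (proj₂ (search-sound _ x found)))

  open CourseOfValues largest next next-local
    renaming (fix to role; fix-unfold to role-unfold)

  inT-complete : ∀ {x} → InT x → inT x ≡ true
  inT-complete = dec-true (any? _)

  inT-sound : ∀ {x} → inT x ≡ true → InT x
  inT-sound = does-sound (any? _)

  isSmallest-role : ∀ x → isSmallest (role x) ≡ inT x
  isSmallest-role x = trans (cong isSmallest (role-unfold x)) (by-cases (inT x))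
    where
    not-found-smallest : ∀ r → isSmallest (maybe′ (successor ∘′ role) largest r) ≡ false
    not-found-smallest nothing  = refl
    not-found-smallest (just y) with role y
    ... | smallest = refl
    ... | middle   = refl
    ... | largest  = refl
    by-cases : ∀ b → isSmallest (if b then smallest
                        else maybe′ (successor ∘′ role) largest (search (isPartner role x) x)) ≡ b
    by-cases true  = refl
    by-cases false = not-found-smallest (search (isPartner role x) x)

  #smallest #middle #largest #notSmallest #notLargest : ℕ → ℕ
  #smallest    = count isSmallest role
  #middle      = count isMiddle role
  #largest     = count isLargest role
  #notSmallest = count notSmallest role
  #notLargest  = count notLargest role

  #notLargest≡ : ∀ y → #notLargest y ≡ #smallest y + #middle y
  #notLargest≡ y = count-split role y χnotLargest≗

  #notSmallest≡ : ∀ y → #notSmallest y ≡ #middle y + #largest y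
  #notSmallest≡ y = count-split role y χnotSmallest≗

  #roles≡ : ∀ y → #smallest y + (#middle y + #largest y) ≡ y
  #roles≡ y = begin
    #smallest y + (#middle y + #largest y) ≡⟨ cong (#smallest y +_) (#notSmallest≡ y) ⟨
    #smallest y + #notSmallest y           ≡⟨ count-split role y χall≗ ⟨
    count (λ _ → true) role y              ≡⟨ count-all role y ⟩
    y                                      ∎
    where open ≡-Reasoning

  t-increasing : StrictlyIncreasing t
  t-increasing = proj₁ adm

  1≤t : ∀ i → 1 ≤ t i
  1≤t i = proj₁ (proj₂ adm i)

  t≤3i+1 : ∀ i → t i ≤ 3 * toℕ i + 1
  t≤3i+1 i = proj₂ (proj₂ adm i)

  t-position : ∀ i → t i ≡ suc (ℕ.pred (t i))
  t-position i = sym (suc-pred (t i) {{>-nonZero (1≤t i)}})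

  t-counted : ∀ i {x} → t i ≤ x → suc (#smallest (ℕ.pred (t i))) ≤ #smallest x
  t-counted i {x} tᵢ≤x = begin
    suc (#smallest p)  ≡⟨ count-hit isSmallest role p p-smallest ⟨
    #smallest (suc p)  ≤⟨ count-mono isSmallest role (subst (_≤ x) (t-position i) tᵢ≤x) ⟩
    #smallest x        ∎
    where
    open ≤-Reasoning
    p : ℕ
    p = ℕ.pred (t i)
    p-smallest : isSmallest (role p) ≡ true
    p-smallest = trans (isSmallest-role p) (inT-complete (i , t-position i))

  #smallest-≥ : ∀ k (k<n : k < n) {x} → t (fromℕ< k<n) ≤ x → suc k ≤ #smallest x
  #smallest-≥ zero    k<n tₖ≤x = ≤-trans (s≤s z≤n) (t-counted _ tₖ≤x)
  #smallest-≥ (suc k) k<n tₖ≤x =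
    ≤-trans (s≤s (#smallest-≥ k k<n′ (≤-pred (subst (t kᶠ <_) (t-position _) tₖ<tₖ₊₁))))
            (t-counted _ tₖ≤x)
    where
    k<n′ : k < n
    k<n′ = <-trans (n<1+n k) k<n
    kᶠ : Fin n
    kᶠ = fromℕ< k<n′
    tₖ<tₖ₊₁ : t kᶠ < t (fromℕ< k<n)
    tₖ<tₖ₊₁ = t-increasing kᶠ (fromℕ< k<n)
      (subst₂ _<_ (sym (toℕ-fromℕ< k<n′)) (sym (toℕ-fromℕ< k<n)) (n<1+n k))

  reached : ℕ → Subset n
  reached x = tabulate λ i → does (t i ≤? x)

  ∈-reached : ∀ {i x} → t i ≤ x → i ∈ reached x
  ∈-reached {i} {x} tᵢ≤x =
    lookup⇒[]= i (reached x) (trans (lookup∘tabulate _ i) (dec-true (t i ≤? x) tᵢ≤x))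

  ∈-reached⁻ : ∀ {i x} → i ∈ reached x → t i ≤ x
  ∈-reached⁻ {i} {x} i∈ =
    does-sound (t i ≤? x) (trans (sym (lookup∘tabulate _ i)) ([]=⇒lookup i∈))

  reached-⊆ : ∀ {x} → reached x ⊆ reached (suc x)
  reached-⊆ i∈ = ∈-reached (m≤n⇒m≤1+n (∈-reached⁻ i∈))

  reached-⊂ : ∀ {i x} → t i ≡ suc x → reached x ⊂ reached (suc x)
  reached-⊂ {i} {x} tᵢ≡1+x =
    reached-⊆ ,
    i , ∈-reached (≤-reflexive tᵢ≡1+x) ,
    λ i∈ → <-irrefl refl (subst (_≤ x) tᵢ≡1+x (∈-reached⁻ i∈))

  #smallest≤∣reached∣ : ∀ x → #smallest x ≤ ∣ reached x ∣
  #smallest≤∣reached∣ zero = z≤n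
  #smallest≤∣reached∣ (suc x) with inT x in x∈T | isSmallest-role x
  ... | true  | smallest-x = begin
    #smallest (suc x)      ≡⟨ count-hit isSmallest role x smallest-x ⟩
    suc (#smallest x)      ≤⟨ s≤s (#smallest≤∣reached∣ x) ⟩
    suc ∣ reached x ∣      ≤⟨ p⊂q⇒∣p∣<∣q∣ (reached-⊂ (proj₂ (inT-sound x∈T))) ⟩
    ∣ reached (suc x) ∣    ∎
    where open ≤-Reasoning
  ... | false | not-smallest-x = begin
    #smallest (suc x)      ≡⟨ count-miss isSmallest role x not-smallest-x ⟩
    #smallest x            ≤⟨ #smallest≤∣reached∣ x ⟩
    ∣ reached x ∣          ≤⟨ p⊆q⇒∣p∣≤∣q∣ reached-⊆ ⟩
    ∣ reached (suc x) ∣    ∎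
    where open ≤-Reasoning

  #smallest≤n : ∀ x → #smallest x ≤ n
  #smallest≤n x = ≤-trans (#smallest≤∣reached∣ x) (∣p∣≤n (reached x))

  m : ℕ
  m = 3 * n

  Balanced : ℕ → Set
  Balanced x = #smallest x ≡ #middle x × #middle x ≡ #largest x

  balanced-size : ∀ {x} → Balanced x → 3 * #smallest x ≡ x
  balanced-size {x} (s≡m , m≡l) = begin
    3 * k                ≡⟨ cong (λ z → k + (k + z)) (+-identityʳ k) ⟩
    k + (k + k)          ≡⟨ cong (λ z → k + (z + z)) s≡m ⟩
    k + (#middle x + #middle x)   ≡⟨ cong (λ z → k + (#middle x + z)) m≡l ⟩
    k + (#middle x + #largest x)  ≡⟨ #roles≡ x ⟩
    x                    ∎
    where
    open ≡-Reasoning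
    k : ℕ
    k = #smallest x

  -- Here x = 3k with k = #smallest x. Since t_{k+1} ≤ x would give k + 1 smallest
  -- positions below x, the bound t_{k+1} ≤ 3k + 1 forces t_{k+1} = x + 1.
  balanced⇒inT : ∀ {x} → x < m → Balanced x → inT x ≡ true
  balanced⇒inT {x} x<m balanced = by-cases (t i ≤? x)
    where
    k : ℕ
    k = #smallest x
    3k≡x : 3 * k ≡ x
    3k≡x = balanced-size balanced
    k<n : k < n
    k<n = *-cancelˡ-< 3 k n (subst (_< m) (sym 3k≡x) x<m)
    i : Fin n
    i = fromℕ< k<n
    tᵢ≤1+x : t i ≤ suc x
    tᵢ≤1+x = subst (t i ≤_) (trans (cong (λ z → 3 * z + 1) (toℕ-fromℕ< k<n))
                                   (trans (+-comm (3 * k) 1) (cong suc 3k≡x)))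
                             (t≤3i+1 i)
    by-cases : Dec (t i ≤ x) → inT x ≡ true
    by-cases (yes tᵢ≤x) = ⊥-elim (<-irrefl refl (#smallest-≥ k k<n tᵢ≤x))
    by-cases (no tᵢ≰x)  = inT-complete (i , ≤-antisym tᵢ≤1+x (≰⇒> tᵢ≰x))

  IsPartner : ℕ → ℕ → Set
  IsPartner x y = notLargest (role y) ≡ true × #notLargest y ≡ #notSmallest x

  partner-search : ∀ {x s} → s < x → IsPartner x s → search (isPartner role x) x ≡ just s
  partner-search {x} {s} s<x (notLargest-s , rank≡) =
    search-unique (isPartner role x) x (∧≡ᵇ-complete notLargest-s rank≡) s<x
      (λ {y} _ found → let (notLargest-y , rank≡′) = ∧≡ᵇ-sound _ _ found in
        count-injective notLargest role notLargest-y notLargest-s (trans rank≡′ (sym rank≡)))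

  role-descent : ∀ {x s} → inT x ≡ false → search (isPartner role x) x ≡ just s →
                 role x ≡ successor (role s)
  role-descent {x} x∉T found = begin
    role x              ≡⟨ role-unfold x ⟩
    next role x         ≡⟨ cong (if_then smallest else r) x∉T ⟩
    r                   ≡⟨ cong (maybe′ (successor ∘′ role) largest) found ⟩
    successor (role _)  ∎
    where
    open ≡-Reasoning
    r : Role
    r = maybe′ (successor ∘′ role) largest (search (isPartner role x) x)

  role-smallest : ∀ {x} → inT x ≡ true → role x ≡ smallest
  role-smallest {x} x∈T = isSmallest⇒≡ (trans (isSmallest-role x) x∈T)

  -- front is the leftmost non-largest position not yet matched by a descent before x
  -- (x itself if there is none).
  record Frontier (x : ℕ) : Set where
    field
      front           : ℕ
      front≤x         : front ≤ x
      #smallest-front : #smallest front ≡ #middle x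
      #middle-front   : #middle front ≡ #largest x
      front-open      : front ≡ x ⊎ notLargest (role front) ≡ true

  front-rank : ∀ {x} (F : Frontier x) → #notLargest (Frontier.front F) ≡ #notSmallest x
  front-rank {x} F = begin
    #notLargest front                ≡⟨ #notLargest≡ front ⟩
    #smallest front + #middle front  ≡⟨ cong₂ _+_ #smallest-front #middle-front ⟩
    #middle x + #largest x           ≡⟨ #notSmallest≡ x ⟨
    #notSmallest x                   ∎
    where
    open Frontier F
    open ≡-Reasoning

  front-is-partner : ∀ {x} → x < m → inT x ≡ false → (F : Frontier x) →
                     Frontier.front F < x × IsPartner x (Frontier.front F)
  front-is-partner {x} x<m x∉T F = by-cases (m≤n⇒m<n∨m≡n front≤x) front-open
    where
    open Frontier F
    front≢x : front ≢ x
    front≢x front≡x = not-¬ (balanced⇒inT x<m balanced) x∉T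
      where
      balanced : Balanced x
      balanced = subst (λ z → #smallest z ≡ #middle x) front≡x #smallest-front ,
                 subst (λ z → #middle z ≡ #largest x) front≡x #middle-front
    by-cases : front < x ⊎ front ≡ x → front ≡ x ⊎ notLargest (role front) ≡ true →
               front < x × IsPartner x front
    by-cases (inj₂ front≡x) _                 = ⊥-elim (front≢x front≡x)
    by-cases (inj₁ front<x) (inj₁ front≡x)    = ⊥-elim (front≢x front≡x)
    by-cases (inj₁ front<x) (inj₂ open-front) = front<x , open-front , front-rank F

  frontier-suc-inT : ∀ {x} → inT x ≡ true → Frontier x → Frontier (suc x)
  frontier-suc-inT {x} x∈T F = record
    { front           = front
    ; front≤x         = m≤n⇒m≤1+n front≤x
    ; #smallest-front = trans #smallest-front (sym (count-miss isMiddle role x x-not-middle))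
    ; #middle-front   = trans #middle-front (sym (count-miss isLargest role x x-not-largest))
    ; front-open      = inj₂ ([ front≡x⇒open , id ]′ front-open) }
    where
    open Frontier F
    x-smallest : role x ≡ smallest
    x-smallest = role-smallest x∈T
    x-not-middle : isMiddle (role x) ≡ false
    x-not-middle = cong isMiddle x-smallest
    x-not-largest : isLargest (role x) ≡ false
    x-not-largest = cong isLargest x-smallest
    front≡x⇒open : front ≡ x → notLargest (role front) ≡ true
    front≡x⇒open front≡x = cong notLargest (trans (cong role front≡x) x-smallest)

  matching-preserves-counts : ∀ {s x} → role x ≡ successor (role s) → notLargest (role s) ≡ true →
    #smallest s ≡ #middle x → #middle s ≡ #largest x →
    #smallest (suc s) ≡ #middle (suc x) × #middle (suc s) ≡ #largest (suc x)
  matching-preserves-counts {s} {x} x-role notLargest-s #smallest≡ #middle≡ = by-role (role s) refl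
    where
    open ≡-Reasoning
    by-role : ∀ r → role s ≡ r →
              #smallest (suc s) ≡ #middle (suc x) × #middle (suc s) ≡ #largest (suc x)
    by-role smallest s-smallest =
      (begin
        #smallest (suc s)  ≡⟨ count-hit isSmallest role s (cong isSmallest s-smallest) ⟩
        suc (#smallest s)  ≡⟨ cong suc #smallest≡ ⟩
        suc (#middle x)    ≡⟨ count-hit isMiddle role x (cong isMiddle x-middle) ⟨
        #middle (suc x)    ∎) ,
      (begin
        #middle (suc s)    ≡⟨ count-miss isMiddle role s (cong isMiddle s-smallest) ⟩
        #middle s          ≡⟨ #middle≡ ⟩
        #largest x         ≡⟨ count-miss isLargest role x (cong isLargest x-middle) ⟨
        #largest (suc x)   ∎)
      where
      x-middle : role x ≡ middle
      x-middle = trans x-role (cong successor s-smallest)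
    by-role middle s-middle =
      (begin
        #smallest (suc s)  ≡⟨ count-miss isSmallest role s (cong isSmallest s-middle) ⟩
        #smallest s        ≡⟨ #smallest≡ ⟩
        #middle x          ≡⟨ count-miss isMiddle role x (cong isMiddle x-largest) ⟨
        #middle (suc x)    ∎) ,
      (begin
        #middle (suc s)    ≡⟨ count-hit isMiddle role s (cong isMiddle s-middle) ⟩
        suc (#middle s)    ≡⟨ cong suc #middle≡ ⟩
        suc (#largest x)   ≡⟨ count-hit isLargest role x (cong isLargest x-largest) ⟨
        #largest (suc x)   ∎)
      where
      x-largest : role x ≡ largest
      x-largest = trans x-role (cong successor s-middle)
    by-role largest s-largest with () ← trans (sym (cong notLargest s-largest)) notLargest-s

  frontier-suc-descent : ∀ {x} → x < m → inT x ≡ false → Frontier x → Frontier (suc x)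
  frontier-suc-descent {x} x<m x∉T F = record
    { front           = pos
    ; front≤x         = pos≤w
    ; #smallest-front = trans (counts-unchanged isSmallest λ { largest _ → refl })
                              (proj₁ new-counts)
    ; #middle-front   = trans (counts-unchanged isMiddle λ { largest _ → refl })
                              (proj₂ new-counts)
    ; front-open      = hit-or-end }
    where
    open Frontier F using (front; #smallest-front; #middle-front)
    s<x : front < x
    s<x = proj₁ (front-is-partner x<m x∉T F)
    s-partner : IsPartner x front
    s-partner = proj₂ (front-is-partner x<m x∉T F)
    new-counts : #smallest (suc front) ≡ #middle (suc x) × #middle (suc front) ≡ #largest (suc x)
    new-counts = matching-preserves-counts (role-descent x∉T (partner-search s<x s-partner))
                   (proj₁ s-partner) #smallest-front #middle-front
    open FirstHit (first-hit notLargest role (m≤n⇒m≤1+n s<x))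

  frontier : ∀ x → x ≤ m → Frontier x
  frontier zero _ = record
    { front = 0 ; front≤x = z≤n ; #smallest-front = refl ; #middle-front = refl
    ; front-open = inj₁ refl }
  frontier (suc x) 1+x≤m with inT x in x∈T
  ... | true  = frontier-suc-inT x∈T (frontier x (<⇒≤ 1+x≤m))
  ... | false = frontier-suc-descent 1+x≤m x∈T (frontier x (<⇒≤ 1+x≤m))

  -- An unmatched non-largest position would make #largest m < #smallest m, which together
  -- with #middle m ≤ #smallest m ≤ n leaves fewer than 3n positions.
  all-matched : #notLargest m ≡ #notSmallest m
  all-matched = by-cases (m≤n⇒m<n∨m≡n front≤x) front-open
    where
    F : Frontier m
    F = frontier m ≤-refl
    open Frontier F
    matched-at : front ≡ m → #notLargest m ≡ #notSmallest m
    matched-at front≡m = trans (cong #notLargest (sym front≡m)) (front-rank F)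
    unmatched-impossible : front < m → notLargest (role front) ≡ true → ⊥
    unmatched-impossible front<m open-front = <-irrefl (#roles≡ m) (begin-strict
      #smallest m + (#middle m + #largest m)  <⟨ +-mono-≤-< (#smallest≤n m)
                                                   (+-mono-≤-< #middle≤n #largest<n) ⟩
      n + (n + n)                             ≡⟨ cong (λ z → n + (n + z)) (+-identityʳ n) ⟨
      m                                       ∎)
      where
      open ≤-Reasoning
      #middle≤n : #middle m ≤ n
      #middle≤n = subst (_≤ n) #smallest-front (#smallest≤n front)
      rank< : suc (#notSmallest m) ≤ #notLargest m
      rank< = subst (_≤ #notLargest m) (cong suc (front-rank F))
                    (count-strict notLargest role open-front front<m)
      #largest<#smallest : #largest m < #smallest m
      #largest<#smallest = +-cancelʳ-≤ (#middle m) (suc (#largest m)) (#smallest m)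
        (subst₂ _≤_ (cong suc (trans (#notSmallest≡ m) (+-comm (#middle m) (#largest m))))
                    (#notLargest≡ m) rank<)
      #largest<n : #largest m < n
      #largest<n = <-≤-trans #largest<#smallest (#smallest≤n m)
    by-cases : front < m ⊎ front ≡ m → front ≡ m ⊎ notLargest (role front) ≡ true →
               #notLargest m ≡ #notSmallest m
    by-cases (inj₂ front≡m) _                  = matched-at front≡m
    by-cases (inj₁ _)       (inj₁ front≡m)     = matched-at front≡m
    by-cases (inj₁ front<m) (inj₂ open-front)  = ⊥-elim (unmatched-impossible front<m open-front)

  opaque
    down : ℕ → ℕ
    down x = fromMaybe x (search (isPartner role x) x)

    down-found : ∀ {x s} → search (isPartner role x) x ≡ just s → down x ≡ s
    down-found {x} = cong (fromMaybe x)

  record DownSpec (x : ℕ) : Set where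
    field
      down<     : down x < x
      partner   : IsPartner x (down x)
      role-down : role x ≡ successor (role (down x))

  down-spec : ∀ {x} → x < m → inT x ≡ false → DownSpec x
  down-spec {x} x<m x∉T = record
    { down<     = subst (_< x) (sym down≡s) s<x
    ; partner   = subst (IsPartner x) (sym down≡s) s-partner
    ; role-down = trans (role-descent x∉T found) (cong (successor ∘′ role) (sym down≡s)) }
    where
    F : Frontier x
    F = frontier x (<⇒≤ x<m)
    s : ℕ
    s = Frontier.front F
    s<x : s < x
    s<x = proj₁ (front-is-partner x<m x∉T F)
    s-partner : IsPartner x s
    s-partner = proj₂ (front-is-partner x<m x∉T F)
    found : search (isPartner role x) x ≡ just s
    found = partner-search s<x s-partner
    down≡s : down x ≡ s
    down≡s = down-found found

  isDescentOfRank : ℕ → ℕ → Bool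
  isDescentOfRank r x = notSmallest (role x) ∧ (#notSmallest x ≡ᵇ r)

  opaque
    up : ℕ → ℕ
    up v = fromMaybe v (search (isDescentOfRank (#notLargest v)) m)

    up-found : ∀ {v y} → search (isDescentOfRank (#notLargest v)) m ≡ just y → up v ≡ y
    up-found {v} = cong (fromMaybe v)

  notSmallest-role : ∀ {x} → inT x ≡ false → notSmallest (role x) ≡ true
  notSmallest-role {x} x∉T = cong not (trans (isSmallest-role x) x∉T)

  record UpSpec (v : ℕ) : Set where
    field
      up<m    : up v < m
      up∉T    : inT (up v) ≡ false
      rank-up : #notSmallest (up v) ≡ #notLargest v

  up-spec : ∀ {v} → v < m → notLargest (role v) ≡ true → UpSpec v
  up-spec {v} v<m notLargest-v = record
    { up<m    = subst (_< m) (sym up≡y) y<m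
    ; up∉T    = subst (λ z → inT z ≡ false) (sym up≡y) y∉T
    ; rank-up = subst (λ z → #notSmallest z ≡ #notLargest v) (sym up≡y) rank-y }
    where
    rank<end : #notLargest v < #notSmallest m
    rank<end = subst (#notLargest v <_) all-matched (count-strict notLargest role notLargest-v v<m)
    reached-y : Σ ℕ λ y → y < m × notSmallest (role y) ≡ true × #notSmallest y ≡ #notLargest v
    reached-y = count-reaches notSmallest role m rank<end
    y : ℕ
    y = proj₁ reached-y
    y<m : y < m
    y<m = proj₁ (proj₂ reached-y)
    notSmallest-y : notSmallest (role y) ≡ true
    notSmallest-y = proj₁ (proj₂ (proj₂ reached-y))
    rank-y : #notSmallest y ≡ #notLargest v
    rank-y = proj₂ (proj₂ (proj₂ reached-y))
    y∉T : inT y ≡ false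
    y∉T = trans (sym (isSmallest-role y)) (not-injective notSmallest-y)
    up≡y : up v ≡ y
    up≡y = up-found (search-unique (isDescentOfRank (#notLargest v)) m
      (∧≡ᵇ-complete notSmallest-y rank-y) y<m
      (λ {z} _ found → let (notSmallest-z , rank-z) = ∧≡ᵇ-sound _ _ found in
        count-injective notSmallest role notSmallest-z notSmallest-y (trans rank-z (sym rank-y))))

  down∘up : ∀ {v} → v < m → notLargest (role v) ≡ true → down (up v) ≡ v
  down∘up {v} v<m notLargest-v =
    count-injective notLargest role (proj₁ partner) notLargest-v (trans (proj₂ partner) rank-up)
    where
    open UpSpec (up-spec v<m notLargest-v)
    open DownSpec (down-spec up<m up∉T)

  up∘down : ∀ {x} → x < m → inT x ≡ false → up (down x) ≡ x
  up∘down {x} x<m x∉T =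
    count-injective notSmallest role (notSmallest-role up∉T) (notSmallest-role x∉T)
      (trans rank-up (proj₂ partner))
    where
    open DownSpec (down-spec x<m x∉T)
    open UpSpec (up-spec (<-trans down< x<m) (proj₁ partner))

  down-monotone : ∀ {x y} → x < y → y < m → inT x ≡ false → inT y ≡ false → down x < down y
  down-monotone {x} {y} x<y y<m x∉T y∉T =
    count-reflects-< notLargest role (proj₁ (DownSpec.partner Dx)) (proj₁ (DownSpec.partner Dy))
      (subst₂ _<_ (sym (proj₂ (DownSpec.partner Dx))) (sym (proj₂ (DownSpec.partner Dy)))
        (count-strict notSmallest role (notSmallest-role x∉T) x<y))
    where
    Dx : DownSpec x
    Dx = down-spec (<-trans x<y y<m) x∉T
    Dy : DownSpec y
    Dy = down-spec y<m y∉T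

  up-monotone : ∀ {v w} → v < w → w < m → notLargest (role v) ≡ true → notLargest (role w) ≡ true →
                up v < up w
  up-monotone {v} {w} v<w w<m notLargest-v notLargest-w =
    count-reflects-< notSmallest role (notSmallest-role (UpSpec.up∉T Uv))
      (notSmallest-role (UpSpec.up∉T Uw))
      (subst₂ _<_ (sym (UpSpec.rank-up Uv)) (sym (UpSpec.rank-up Uw))
        (count-strict notLargest role notLargest-v v<w))
    where
    Uv : UpSpec v
    Uv = up-spec (<-trans v<w w<m) notLargest-v
    Uw : UpSpec w
    Uw = up-spec w<m notLargest-w

  role-up : ∀ {v} → v < m → notLargest (role v) ≡ true → role (up v) ≡ successor (role v)
  role-up {v} v<m notLargest-v =
    trans role-down (cong (successor ∘′ role) (down∘up v<m notLargest-v))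
    where
    open UpSpec (up-spec v<m notLargest-v)
    open DownSpec (down-spec up<m up∉T)

  opaque
    π̂ : ℕ → ℕ
    π̂ x = if inT x then up (up x) else down x

    π̂-smallest : ∀ {x} → inT x ≡ true → π̂ x ≡ up (up x)
    π̂-smallest {x} x∈T = cong (if_then up (up x) else down x) x∈T

    π̂-descent : ∀ {x} → inT x ≡ false → π̂ x ≡ down x
    π̂-descent {x} x∉T = cong (if_then up (up x) else down x) x∉T

  record CycleFrom (a : ℕ) : Set where
    field
      a<b   : a < up a
      b<c   : up a < up (up a)
      c<m   : up (up a) < m
      b-middle : role (up a) ≡ middle
      π̂a≡c  : π̂ a ≡ up (up a)
      π̂b≡a  : π̂ (up a) ≡ a
      π̂c≡b  : π̂ (up (up a)) ≡ up a

    b<m : up a < m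
    b<m = <-trans b<c c<m

    a<m : a < m
    a<m = <-trans a<b b<m

  cycle-from : ∀ {a} → a < m → inT a ≡ true → CycleFrom a
  cycle-from {a} a<m a∈T = record
    { a<b = subst (_< up a) (down∘up a<m notLargest-a) (DownSpec.down< Db)
    ; b<c = subst (_< up (up a)) (down∘up b<m notLargest-b) (DownSpec.down< Dc)
    ; c<m = UpSpec.up<m Uc
    ; b-middle = b-middle
    ; π̂a≡c = π̂-smallest a∈T
    ; π̂b≡a = trans (π̂-descent (UpSpec.up∉T Ub)) (down∘up a<m notLargest-a)
    ; π̂c≡b = trans (π̂-descent (UpSpec.up∉T Uc)) (down∘up b<m notLargest-b) }
    where
    notLargest-a : notLargest (role a) ≡ true
    notLargest-a = cong notLargest (role-smallest a∈T)
    Ub : UpSpec a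
    Ub = up-spec a<m notLargest-a
    b<m : up a < m
    b<m = UpSpec.up<m Ub
    b-middle : role (up a) ≡ middle
    b-middle = trans (role-up a<m notLargest-a) (cong successor (role-smallest a∈T))
    notLargest-b : notLargest (role (up a)) ≡ true
    notLargest-b = cong notLargest b-middle
    Uc : UpSpec (up a)
    Uc = up-spec b<m notLargest-b
    Db : DownSpec (up a)
    Db = down-spec b<m (UpSpec.up∉T Ub)
    Dc : DownSpec (up (up a))
    Dc = down-spec (UpSpec.up<m Uc) (UpSpec.up∉T Uc)

  Orbit : ℕ → Set
  Orbit x = Σ ℕ λ a → CycleFrom a × (a ≡ x ⊎ up a ≡ x ⊎ up (up a) ≡ x)

  orbit : ∀ {x} → x < m → Orbit x
  orbit {x} x<m with inT x in x∈T
  ... | true  = x , cycle-from x<m x∈T , inj₁ refl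
  ... | false = by-role (role (down x)) refl
    where
    open DownSpec (down-spec x<m x∈T)
    b<m : down x < m
    b<m = <-trans down< x<m
    by-role : ∀ r → role (down x) ≡ r → Orbit x
    by-role smallest b-smallest =
      down x , cycle-from b<m (trans (sym (isSmallest-role _)) (cong isSmallest b-smallest)) ,
      inj₂ (inj₁ (up∘down x<m x∈T))
    by-role middle b-middle =
      down b , cycle-from a<m (trans (sym (isSmallest-role _)) (cong isSmallest a-smallest)) ,
      inj₂ (inj₂ (trans (cong up (up∘down b<m b∉T)) (up∘down x<m x∈T)))
      where
      b : ℕ
      b = down x
      b∉T : inT b ≡ false
      b∉T = trans (sym (isSmallest-role b)) (cong isSmallest b-middle)
      Db : DownSpec b
      Db = down-spec b<m b∉T
      a<m : down b < m
      a<m = <-trans (DownSpec.down< Db) b<m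
      a-smallest : role (down b) ≡ smallest
      a-smallest = successor≡middle (trans (sym (DownSpec.role-down Db)) b-middle)
    by-role largest b-largest with () ← trans (sym (cong notLargest b-largest)) (proj₁ partner)

  π̂<m : ∀ {x} → x < m → π̂ x < m
  π̂<m x<m with orbit x<m
  ... | a , C , inj₁ refl        = subst (_< m) (sym π̂a≡c) c<m where open CycleFrom C
  ... | a , C , inj₂ (inj₁ refl) = subst (_< m) (sym π̂b≡a) a<m where open CycleFrom C
  ... | a , C , inj₂ (inj₂ refl) = subst (_< m) (sym π̂c≡b) b<m where open CycleFrom C

  π̂³≡id : ∀ {x} → x < m → π̂ (π̂ (π̂ x)) ≡ x
  π̂³≡id x<m with orbit x<m
  ... | a , C , inj₁ refl        = trans (cong (π̂ ∘′ π̂) π̂a≡c) (trans (cong π̂ π̂c≡b) π̂b≡a)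
    where open CycleFrom C
  ... | a , C , inj₂ (inj₁ refl) = trans (cong (π̂ ∘′ π̂) π̂b≡a) (trans (cong π̂ π̂a≡c) π̂c≡b)
    where open CycleFrom C
  ... | a , C , inj₂ (inj₂ refl) = trans (cong (π̂ ∘′ π̂) π̂c≡b) (trans (cong π̂ π̂b≡a) π̂a≡c)
    where open CycleFrom C

  π̂≢id : ∀ {x} → x < m → π̂ x ≢ x
  π̂≢id x<m with orbit x<m
  ... | a , C , inj₁ refl        = >⇒≢ (<-trans a<b b<c) ∘′ trans (sym π̂a≡c) where open CycleFrom C
  ... | a , C , inj₂ (inj₁ refl) = <⇒≢ a<b ∘′ trans (sym π̂b≡a) where open CycleFrom C
  ... | a , C , inj₂ (inj₂ refl) = <⇒≢ b<c ∘′ trans (sym π̂c≡b) where open CycleFrom C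

  π̂²≢id : ∀ {x} → x < m → π̂ (π̂ x) ≢ x
  π̂²≢id x<m with orbit x<m
  ... | a , C , inj₁ refl        = >⇒≢ a<b ∘′ trans (sym (trans (cong π̂ π̂a≡c) π̂c≡b))
    where open CycleFrom C
  ... | a , C , inj₂ (inj₁ refl) = >⇒≢ b<c ∘′ trans (sym (trans (cong π̂ π̂b≡a) π̂a≡c))
    where open CycleFrom C
  ... | a , C , inj₂ (inj₂ refl) =
    <⇒≢ (<-trans a<b b<c) ∘′ trans (sym (trans (cong π̂ π̂c≡b) π̂b≡a))
    where open CycleFrom C

  π̂-312 : ∀ {x} → x < m → x < π̂ x → π̂ (π̂ x) < π̂ x
  π̂-312 x<m x<π̂x with orbit x<m
  ... | a , C , inj₁ refl        = subst₂ _<_ (sym (trans (cong π̂ π̂a≡c) π̂c≡b)) (sym π̂a≡c) b<c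
    where open CycleFrom C
  ... | a , C , inj₂ (inj₁ refl) = ⊥-elim (<-asym (subst (up a <_) π̂b≡a x<π̂x) a<b)
    where open CycleFrom C
  ... | a , C , inj₂ (inj₂ refl) = ⊥-elim (<-asym (subst (up (up a) <_) π̂c≡b x<π̂x) b<c)
    where open CycleFrom C

  π̂-monotone-on-classes : ∀ {u w} → u < w → w < m → inT u ≡ inT w → π̂ u < π̂ w
  π̂-monotone-on-classes {u} {w} u<w w<m same-class with inT w in w∈T
  ... | false = subst₂ _<_ (sym (π̂-descent same-class)) (sym (π̂-descent w∈T))
                  (down-monotone u<w w<m same-class w∈T)
  ... | true  = subst₂ _<_ (sym (π̂-smallest same-class)) (sym (π̂-smallest w∈T))
                  (up-monotone (up-monotone u<w w<m (notLargest-smallest same-class)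
                                              (notLargest-smallest w∈T))
                               (CycleFrom.b<m Cw) (notLargest-middle Cu) (notLargest-middle Cw))
    where
    notLargest-smallest : ∀ {a} → inT a ≡ true → notLargest (role a) ≡ true
    notLargest-smallest a∈T = cong notLargest (role-smallest a∈T)
    notLargest-middle : ∀ {a} → CycleFrom a → notLargest (role (up a)) ≡ true
    notLargest-middle C = cong notLargest (CycleFrom.b-middle C)
    Cu : CycleFrom u
    Cu = cycle-from (<-trans u<w w<m) same-class
    Cw : CycleFrom w
    Cw = cycle-from w<m w∈T

  smallest-in-cycle⇔inT : ∀ {x} → x < m → (x < π̂ x × x < π̂ (π̂ x)) ⇔ (inT x ≡ true)
  smallest-in-cycle⇔inT {x} x<m = mk⇔ to from
    where
    to : x < π̂ x × x < π̂ (π̂ x) → inT x ≡ true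
    to (x<π̂x , _) with inT x in x∈T
    ... | true  = refl
    ... | false = ⊥-elim (<-asym (subst (x <_) (π̂-descent x∈T) x<π̂x)
                                 (DownSpec.down< (down-spec x<m x∈T)))
    from : inT x ≡ true → x < π̂ x × x < π̂ (π̂ x)
    from x∈T = subst (x <_) (sym π̂a≡c) (<-trans a<b b<c) ,
               subst (x <_) (sym (trans (cong π̂ π̂a≡c) π̂c≡b)) a<b
      where open CycleFrom (cycle-from x<m x∈T)

  πᶠ : Fin m → Fin m
  πᶠ x = fromℕ< (π̂<m (toℕ<n x))

  toℕ-πᶠ : ∀ x → toℕ (πᶠ x) ≡ π̂ (toℕ x)
  toℕ-πᶠ x = toℕ-fromℕ< _

  toℕ-πᶠ² : ∀ x → toℕ (πᶠ (πᶠ x)) ≡ π̂ (π̂ (toℕ x))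
  toℕ-πᶠ² x = trans (toℕ-πᶠ (πᶠ x)) (cong π̂ (toℕ-πᶠ x))

  πᶠ³≗id : ∀ x → πᶠ (πᶠ (πᶠ x)) ≡ x
  πᶠ³≗id x = toℕ-injective (begin
    toℕ (πᶠ (πᶠ (πᶠ x)))  ≡⟨ toℕ-πᶠ (πᶠ (πᶠ x)) ⟩
    π̂ (toℕ (πᶠ (πᶠ x)))   ≡⟨ cong π̂ (toℕ-πᶠ² x) ⟩
    π̂ (π̂ (π̂ (toℕ x)))     ≡⟨ π̂³≡id (toℕ<n x) ⟩
    toℕ x                 ∎)
    where open ≡-Reasoning

  π : Permutation′ m
  π = permutation πᶠ (λ x → πᶠ (πᶠ x)) πᶠ³≗id πᶠ³≗id

  π-only-3-cycles : OnlyThreeCycles π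
  π-only-3-cycles x =
    (λ πx≡x → π̂≢id (toℕ<n x) (trans (sym (toℕ-πᶠ x)) (cong toℕ πx≡x))) ,
    (λ π²x≡x → π̂²≢id (toℕ<n x) (trans (sym (toℕ-πᶠ² x)) (cong toℕ π²x≡x))) ,
    πᶠ³≗id x

  π-avoids-321 : Avoids321 π
  π-avoids-321 i j k i<j j<k (πk<πj , πj<πi)
    with two-of-three-equal (inT (toℕ i)) (inT (toℕ j)) (inT (toℕ k))
  ... | inj₁ i~j        = <-asym π̂j<π̂i (π̂-monotone-on-classes i<j (toℕ<n j) i~j)
    where
    π̂j<π̂i : π̂ (toℕ j) < π̂ (toℕ i)
    π̂j<π̂i = subst₂ _<_ (toℕ-πᶠ j) (toℕ-πᶠ i) πj<πi
  ... | inj₂ (inj₁ j~k) = <-asym π̂k<π̂j (π̂-monotone-on-classes j<k (toℕ<n k) j~k)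
    where
    π̂k<π̂j : π̂ (toℕ k) < π̂ (toℕ j)
    π̂k<π̂j = subst₂ _<_ (toℕ-πᶠ k) (toℕ-πᶠ j) πk<πj
  ... | inj₂ (inj₂ i~k) =
    <-asym π̂k<π̂i (π̂-monotone-on-classes (<-trans i<j j<k) (toℕ<n k) i~k)
    where
    π̂k<π̂i : π̂ (toℕ k) < π̂ (toℕ i)
    π̂k<π̂i = subst₂ _<_ (toℕ-πᶠ k) (toℕ-πᶠ i) (<-trans πk<πj πj<πi)

  π-all-312 : All312 π
  π-all-312 a b c a<b b<c (inj₂ (πa≡c , πc≡b , πb≡a)) =
    subst₂ _<_ (sym (cong toℕ πb≡a)) (sym (cong toℕ πc≡b)) a<b ,
    subst₂ _<_ (sym (cong toℕ πc≡b)) (sym (cong toℕ πa≡c)) b<c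
  π-all-312 a b c a<b b<c (inj₁ (πa≡b , πb≡c , _)) =
    ⊥-elim (<-asym b<c (subst₂ _<_ π̂²a≡c π̂a≡b
      (π̂-312 (toℕ<n a) (subst (toℕ a <_) (sym π̂a≡b) a<b))))
    where
    π̂a≡b : π̂ (toℕ a) ≡ toℕ b
    π̂a≡b = trans (sym (toℕ-πᶠ a)) (cong toℕ πa≡b)
    π̂²a≡c : π̂ (π̂ (toℕ a)) ≡ toℕ c
    π̂²a≡c = trans (sym (toℕ-πᶠ² a)) (cong toℕ (trans (cong πᶠ πa≡b) πb≡c))

  π∈B : InB π
  π∈B = π-only-3-cycles , π-avoids-321 , π-all-312

  T1[π]≡T : T1Equals π t
  T1[π]≡T x = inT-sound ∘′ to ∘′ on-ℕ , from-ℕ ∘′ from ∘′ inT-complete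
    where
    open Equivalence (smallest-in-cycle⇔inT (toℕ<n x))
    on-ℕ : InT1 π x → toℕ x < π̂ (toℕ x) × toℕ x < π̂ (π̂ (toℕ x))
    on-ℕ (x<πx , x<π²x) = subst (toℕ x <_) (toℕ-πᶠ x) x<πx ,
                          subst (toℕ x <_) (toℕ-πᶠ² x) x<π²x
    from-ℕ : toℕ x < π̂ (toℕ x) × toℕ x < π̂ (π̂ (toℕ x)) → InT1 π x
    from-ℕ (x<π̂x , x<π̂²x) = subst (toℕ x <_) (sym (toℕ-πᶠ x)) x<π̂x ,
                            subst (toℕ x <_) (sym (toℕ-πᶠ² x)) x<π̂²x

T1Equals⇒SameT1 : ∀ {m n} {σ τ : Permutation′ m} {t : Fin n → ℕ} →
                  T1Equals σ t → T1Equals τ t → SameT1 σ τ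
T1Equals⇒SameT1 T1[σ]≡T T1[τ]≡T =
  (λ x x∈T1 → proj₂ (T1[τ]≡T x) (proj₁ (T1[σ]≡T x) x∈T1)) ,
  (λ x x∈T1 → proj₂ (T1[σ]≡T x) (proj₁ (T1[τ]≡T x) x∈T1))

lemma4p6 : (n : ℕ) → 1 ≤ n → (t : Fin n → ℕ) → Admissible t →
    Σ (Permutation′ (3 * n)) (λ π → (InB π × T1Equals π t) ×
      ((σ : Permutation′ (3 * n)) → InB σ → T1Equals σ t →
        (x : Fin (3 * n)) → σ ⟨$⟩ʳ x ≡ π ⟨$⟩ʳ x))
lemma4p6 n _ t adm = π , (π∈B , T1[π]≡T) , λ σ σ∈B T1[σ]≡T →
  InB-unique-by-T1 σ π σ∈B π∈B (T1Equals⇒SameT1 {σ = σ} {π} {t} T1[σ]≡T T1[π]≡T)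
  where open Construction n t adm
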